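{- Let $DS'$ be a set of signed formulas. Then $DS'$ is satisfiable if and only if there exists a downward saturated set $DS''$ of signed formulas with $DS'\subseteq DS''$.
   Context: Formulas of $C_1$ are built from a countable set $\mathcal{P}$ of propositional letters with the connectives $\neg,\wedge,\vee,\to$. The consistency connective is an abbreviation: $\circ A := \neg(A\wedge\neg A)$. A $C_1$-valuation is a map $v$ from formulas to $\{0,1\}$ such that for all formulas $\alpha,\beta$: $v(\alpha\wedge\beta)=1$ iff $v(\alpha)=v(\beta)=1$; $v(\alpha\vee\beta)=1$ iff $v(\alpha)=1$ or $v(\beta)=1$; $v(\alpha\to\beta)=1$ iff $v(\alpha)=0$ or $v(\beta)=1$; $v(\neg\alpha)=0$ implies $v(\alpha)=1$; $v(\neg\neg\alpha)=1$ implies $v(\alpha)=1$; $v(\circ\alpha)=1$ implies $v(\alpha)=0$ or $v(\neg\alpha)=0$; and for $\oslash\in\{\wedge,\vee,\to\}$, $v(\circ(\alpha\oslash\beta))=0$ implies $v(\circ\alpha)=0$ or $v(\circ\beta)=0$. A signed formula is $\mathsf{T}\,A$ or $\mathsf{F}\,A$ with $A$ a formula; the conjugate of $\mathsf{T}\,A$ is $\mathsf{F}\,A$ and vice versa. Put $v(\mathsf{T}\,A)=v(A)$, $v(\mathsf{F}\,A)=1-v(A)$. A set of signed formulas is satisfiable if some $C_1$-valuation gives value 1 to all its members. The $C_1$ KE rules (for arbitrary formulas $A,B$; in two-premiss rules the first premiss is the main/major premiss and the second the minor/auxiliary premiss): One-premiss rules: from $\mathsf{F}\,A\to B$ infer $\mathsf{T}\,A$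 and $\mathsf{F}\,B$; from $\mathsf{T}\,A\wedge B$ infer $\mathsf{T}\,A$ and $\mathsf{T}\,B$; from $\mathsf{F}\,A\vee B$ infer $\mathsf{F}\,A$ and $\mathsf{F}\,B$; from $\mathsf{F}\,\neg A$ infer $\mathsf{T}\,A$; from $\mathsf{T}\,\neg\neg A$ infer $\mathsf{T}\,A$. Two-premiss rules: from $\mathsf{T}\,A\to B$ and $\mathsf{T}\,A$ infer $\mathsf{T}\,B$; from $\mathsf{T}\,A\to B$ and $\mathsf{F}\,B$ infer $\mathsf{F}\,A$; from $\mathsf{F}\,A\wedge B$ and $\mathsf{T}\,A$ infer $\mathsf{F}\,B$; from $\mathsf{F}\,A\wedge B$ and $\mathsf{T}\,B$ infer $\mathsf{F}\,A$; from $\mathsf{T}\,A\vee B$ and $\mathsf{F}\,A$ infer $\mathsf{T}\,B$; from $\mathsf{T}\,A\vee B$ and $\mathsf{F}\,B$ infer $\mathsf{T}\,A$; from $\mathsf{T}\,\neg A$ and $\mathsf{T}\,\circ A$ infer $\mathsf{F}\,A$; for each $\oslash\in\{\wedge,\vee,\to\}$: from $\mathsf{F}\,\circ(A\oslash B)$ and $\mathsf{T}\,\circ A$ infer $\mathsf{F}\,\circ B$, and from $\mathsf{F}\,\circ(A\oslash B)$ and $\mathsf{T}\,\circ B$ infer $\mathsf{F}\,\circ A$. Branching rule (PB, no premisses): split a branch into one containing $\mathsf{T}\,A$ and one containing $\mathsf{F}\,A$, for any formula $A$. A set $DS$ of signed formulas is downward saturated if: (i) whenever a signed formula is in $DS$,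 its conjugate is not in $DS$; (ii) whenever all premisses of a $C_1$ KE rule other than PB are in $DS$, all its conclusions are in $DS$; (iii) whenever the major premiss of a two-premiss $C_1$ KE rule is in $DS$, either its minor premiss or the conjugate of its minor premiss is in $DS$. -}

module Defs where

open import Data.Nat using (ℕ)
open import Data.Bool using (Bool; true; false; not)
open import Data.Product using (_×_; Σ; ∃)
open import Data.Sum using (_⊎_)
open import Relation.Binary.PropositionalEquality using (_≡_)
open import Relation.Nullary using (¬_)
open import Function.Bundles using (_⇔_)

infixr 4 _⇒_
infixr 5 _⋁_
infixr 6 _⋀_
infix 7 ~_

data Formula : Set where
  var  : ℕ → Formula
  ~_   : Formula → Formula
  _⋀_  : Formula → Formula → Formula
  _⋁_  : Formula → Formula → Formula
  _⇒_  : Formula → Formula → Formula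

∘_ : Formula → Formula
∘ A = ~ (A ⋀ ~ A)

data BinOp : Set where
  and or imp : BinOp

bin : BinOp → Formula → Formula → Formula
bin and A B = A ⋀ B
bin or  A B = A ⋁ B
bin imp A B = A ⇒ B

record IsC1Valuation (v : Formula → Bool) : Set where
  field
    v-∧   : ∀ α β → (v (α ⋀ β) ≡ true) ⇔ (v α ≡ true × v β ≡ true)
    v-∨   : ∀ α β → (v (α ⋁ β) ≡ true) ⇔ (v α ≡ true ⊎ v β ≡ true)
    v-→   : ∀ α β → (v (α ⇒ β) ≡ true) ⇔ (v α ≡ false ⊎ v β ≡ true)
    v-¬   : ∀ α → v (~ α) ≡ false → v α ≡ true
    v-¬¬  : ∀ α → v (~ ~ α) ≡ true → v α ≡ true
    v-∘   : ∀ α → v (∘ α) ≡ true → v α ≡ false ⊎ v (~ α) ≡ false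
    v-∘⊘  : ∀ ⊘ α β → v (∘ (bin ⊘ α β)) ≡ false → v (∘ α) ≡ false ⊎ v (∘ β) ≡ false

data Signed : Set where
  T F : Formula → Signed

conj : Signed → Signed
conj (T A) = F A
conj (F A) = T A

valS : (Formula → Bool) → Signed → Bool
valS v (T A) = v A
valS v (F A) = not (v A)

SSet : Set
SSet = Signed → Bool

infix 4 _∈_ _⊆_
_∈_ : Signed → SSet → Set
s ∈ S = S s ≡ true

_⊆_ : SSet → SSet → Set
S ⊆ S' = ∀ s → s ∈ S → s ∈ S'

Satisfiable : SSet → Set
Satisfiable S = Σ (Formula → Bool) λ v → IsC1Valuation v × (∀ s → s ∈ S → valS v s ≡ true)

-- One-premiss C1 KE rules: OneRule p c  means "from p infer c"
-- (rules with two conclusions are listed once per conclusion)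
data OneRule : Signed → Signed → Set where
  F→₁ : ∀ A B → OneRule (F (A ⇒ B)) (T A)
  F→₂ : ∀ A B → OneRule (F (A ⇒ B)) (F B)
  T∧₁ : ∀ A B → OneRule (T (A ⋀ B)) (T A)
  T∧₂ : ∀ A B → OneRule (T (A ⋀ B)) (T B)
  F∨₁ : ∀ A B → OneRule (F (A ⋁ B)) (F A)
  F∨₂ : ∀ A B → OneRule (F (A ⋁ B)) (F B)
  F¬  : ∀ A → OneRule (F (~ A)) (T A)
  T¬¬ : ∀ A → OneRule (T (~ ~ A)) (T A)

-- Two-premiss C1 KE rules: TwoRule major minor conclusion
data TwoRule : Signed → Signed → Signed → Set where
  T→₁ : ∀ A B → TwoRule (T (A ⇒ B)) (T A) (T B)
  T→₂ : ∀ A B → TwoRule (T (A ⇒ B)) (F B) (F A)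
  F∧₁ : ∀ A B → TwoRule (F (A ⋀ B)) (T A) (F B)
  F∧₂ : ∀ A B → TwoRule (F (A ⋀ B)) (T B) (F A)
  T∨₁ : ∀ A B → TwoRule (T (A ⋁ B)) (F A) (T B)
  T∨₂ : ∀ A B → TwoRule (T (A ⋁ B)) (F B) (T A)
  T¬∘ : ∀ A → TwoRule (T (~ A)) (T (∘ A)) (F A)
  F∘₁ : ∀ ⊘ A B → TwoRule (F (∘ (bin ⊘ A B))) (T (∘ A)) (F (∘ B))
  F∘₂ : ∀ ⊘ A B → TwoRule (F (∘ (bin ⊘ A B))) (T (∘ B)) (F (∘ A))

record DownwardSaturated (DS : SSet) : Set where
  field
    noConj   : ∀ s → s ∈ DS → ¬ (conj s ∈ DS)
    closed₁  : ∀ p c → OneRule p c → p ∈ DS → c ∈ DS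
    closed₂  : ∀ maj min c → TwoRule maj min c → maj ∈ DS → min ∈ DS → c ∈ DS
    analytic : ∀ maj min c → TwoRule maj min c → maj ∈ DS → min ∈ DS ⊎ conj min ∈ DS

-- Soundness: the signed formulas true under a C1-valuation form a downward
-- saturated set, since every KE rule preserves truth and each signed formula
-- or its conjugate is true.
--
-- Completeness (a Hintikka lemma): a downward saturated set DS determines a
-- valuation that is classical on letters and binary connectives and reads a
-- negation ¬A off DS, falling back to the classical ¬v(A) when neither T ¬A
-- nor F ¬A is in DS.  Induction on A shows that it makes every member of DS
-- true; the C1 clauses for ¬, ¬¬ and ∘ then follow from the rules F¬, T¬¬,
-- T¬∘ and F∘, using analyticity to decide the minor premisses.
module Submission where

open import Defs
open import Data.Bool using (Bool; true; false; not; _∧_; _∨_)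
open import Data.Bool.Properties
  using (∧-identityʳ; ∧-zeroʳ; ∨-identityʳ; ∨-zeroʳ; ∨-conicalˡ; ∨-conicalʳ)
open import Data.Product using (Σ; _×_; _,_; proj₁; proj₂)
open import Data.Sum using (_⊎_; inj₁; inj₂)
open import Data.Empty using (⊥-elim)
open import Function.Bundles using (_⇔_; mk⇔; Equivalence)
open import Relation.Binary.PropositionalEquality using (_≡_; _≢_; refl; sym)

open Equivalence using (to; from)

not≡true⇒≡false : ∀ {b} → not b ≡ true → b ≡ false
not≡true⇒≡false {false} _ = refl

≡false⇒not≡true : ∀ {b} → b ≡ false → not b ≡ true
≡false⇒not≡true refl = refl

not≡false⇒≡true : ∀ {b} → not b ≡ false → b ≡ true
not≡false⇒≡true {true} _ = refl

true≢false : ∀ {b} {A : Set} → b ≡ true → b ≡ false → A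
true≢false refl ()

≢true⇒≡false : ∀ {b} → b ≢ true → b ≡ false
≢true⇒≡false {false} _ = refl
≢true⇒≡false {true}  b≢true = ⊥-elim (b≢true refl)

≡-by-⇔ : ∀ {P : Set} {b c} → (b ≡ true ⇔ P) → (c ≡ true ⇔ P) → b ≡ c
≡-by-⇔ {b = true}  b⇔P c⇔P = sym (from c⇔P (to b⇔P refl))
≡-by-⇔ {b = false} {c = false} _ _ = refl
≡-by-⇔ {b = false} {c = true} b⇔P c⇔P with from b⇔P (to c⇔P refl)
... | ()

∧≡true⇔ : ∀ a b → (a ∧ b ≡ true) ⇔ (a ≡ true × b ≡ true)
∧≡true⇔ a b = mk⇔ (split a b) λ { (refl , refl) → refl }
  where
  split : ∀ a b → a ∧ b ≡ true → a ≡ true × b ≡ true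
  split true true _ = refl , refl

∨≡true⇔ : ∀ a b → (a ∨ b ≡ true) ⇔ (a ≡ true ⊎ b ≡ true)
∨≡true⇔ a b = mk⇔ (split a b) (join a b)
  where
  split : ∀ a b → a ∨ b ≡ true → a ≡ true ⊎ b ≡ true
  split true  _ _ = inj₁ refl
  split false _ e = inj₂ e
  join : ∀ a b → a ≡ true ⊎ b ≡ true → a ∨ b ≡ true
  join true  _ _ = refl
  join false _ (inj₂ e) = e

not∨≡true⇔ : ∀ a b → (not a ∨ b ≡ true) ⇔ (a ≡ false ⊎ b ≡ true)
not∨≡true⇔ a b = mk⇔ (split a b) (join a b)
  where
  split : ∀ a b → not a ∨ b ≡ true → a ≡ false ⊎ b ≡ true
  split false _ _ = inj₁ refl
  split true  _ e = inj₂ e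
  join : ∀ a b → a ≡ false ⊎ b ≡ true → not a ∨ b ≡ true
  join false _ _ = refl
  join true  _ (inj₂ e) = e

∧≡false⇒ : ∀ a b → a ∧ b ≡ false → a ≡ false ⊎ b ≡ false
∧≡false⇒ false _ _ = inj₁ refl
∧≡false⇒ true  _ e = inj₂ e

valS-excludes-conj : ∀ v s → valS v s ≡ true → valS v (conj s) ≢ true
valS-excludes-conj v (T A) TA FA = true≢false TA (not≡true⇒≡false FA)
valS-excludes-conj v (F A) FA TA = true≢false TA (not≡true⇒≡false FA)

valS-or-conj : ∀ v s → valS v s ≡ true ⊎ valS v (conj s) ≡ true
valS-or-conj v (T A) with v A
... | true  = inj₁ refl
... | false = inj₂ refl
valS-or-conj v (F A) with v A
... | true  = inj₂ refl
... | false = inj₁ refl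

module _ {v : Formula → Bool} (isC1 : IsC1Valuation v) where
  open IsC1Valuation isC1

  v-⋀ : ∀ A B → v (A ⋀ B) ≡ v A ∧ v B
  v-⋀ A B = ≡-by-⇔ (v-∧ A B) (∧≡true⇔ (v A) (v B))

  v-⋁ : ∀ A B → v (A ⋁ B) ≡ v A ∨ v B
  v-⋁ A B = ≡-by-⇔ (v-∨ A B) (∨≡true⇔ (v A) (v B))

  v-⇒ : ∀ A B → v (A ⇒ B) ≡ not (v A) ∨ v B
  v-⇒ A B = ≡-by-⇔ (v-→ A B) (not∨≡true⇔ (v A) (v B))

  oneRule-sound : ∀ {p c} → OneRule p c → valS v p ≡ true → valS v c ≡ true
  oneRule-sound (F→₁ A B) h rewrite v-⇒ A B =
    not≡false⇒≡true (∨-conicalˡ _ _ (not≡true⇒≡false h))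
  oneRule-sound (F→₂ A B) h rewrite v-⇒ A B =
    ≡false⇒not≡true (∨-conicalʳ _ _ (not≡true⇒≡false h))
  oneRule-sound (T∧₁ A B) h = proj₁ (to (v-∧ A B) h)
  oneRule-sound (T∧₂ A B) h = proj₂ (to (v-∧ A B) h)
  oneRule-sound (F∨₁ A B) h rewrite v-⋁ A B =
    ≡false⇒not≡true (∨-conicalˡ _ _ (not≡true⇒≡false h))
  oneRule-sound (F∨₂ A B) h rewrite v-⋁ A B =
    ≡false⇒not≡true (∨-conicalʳ _ _ (not≡true⇒≡false h))
  oneRule-sound (F¬ A)    h = v-¬ A (not≡true⇒≡false h)
  oneRule-sound (T¬¬ A)   h = v-¬¬ A h

  twoRule-sound : ∀ {maj min c} → TwoRule maj min c →
                  valS v maj ≡ true → valS v min ≡ true → valS v c ≡ true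
  twoRule-sound (T→₁ A B) h₁ h₂ rewrite v-⇒ A B | h₂ = h₁
  twoRule-sound (T→₂ A B) h₁ h₂
    rewrite v-⇒ A B | not≡true⇒≡false h₂ | ∨-identityʳ (not (v A)) = h₁
  twoRule-sound (F∧₁ A B) h₁ h₂ rewrite v-⋀ A B | h₂ = h₁
  twoRule-sound (F∧₂ A B) h₁ h₂ rewrite v-⋀ A B | h₂ | ∧-identityʳ (v A) = h₁
  twoRule-sound (T∨₁ A B) h₁ h₂ rewrite v-⋁ A B | not≡true⇒≡false h₂ = h₁
  twoRule-sound (T∨₂ A B) h₁ h₂
    rewrite v-⋁ A B | not≡true⇒≡false h₂ | ∨-identityʳ (v A) = h₁
  twoRule-sound (T¬∘ A) h₁ h₂ with v-∘ A h₂
  ... | inj₁ vA≡false  = ≡false⇒not≡true vA≡false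
  ... | inj₂ v¬A≡false = true≢false h₁ v¬A≡false
  twoRule-sound (F∘₁ ⊘ A B) h₁ h₂ with v-∘⊘ ⊘ A B (not≡true⇒≡false h₁)
  ... | inj₁ v∘A≡false = true≢false h₂ v∘A≡false
  ... | inj₂ v∘B≡false = ≡false⇒not≡true v∘B≡false
  twoRule-sound (F∘₂ ⊘ A B) h₁ h₂ with v-∘⊘ ⊘ A B (not≡true⇒≡false h₁)
  ... | inj₁ v∘A≡false = ≡false⇒not≡true v∘A≡false
  ... | inj₂ v∘B≡false = true≢false h₂ v∘B≡false

  valS-downwardSaturated : DownwardSaturated (valS v)
  valS-downwardSaturated = record
    { noConj   = valS-excludes-conj v
    ; closed₁  = λ _ _ → oneRule-sound
    ; closed₂  = λ _ _ _ → twoRule-sound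
    ; analytic = λ _ min _ _ _ → valS-or-conj v min
    }

forced : (inT inF default : Bool) → Bool
forced true  _     _ = true
forced false true  _ = false
forced false false d = d

forced≡true⇒ : ∀ t f d → forced t f d ≡ true → t ≡ true ⊎ d ≡ true
forced≡true⇒ true  _     _ _ = inj₁ refl
forced≡true⇒ false false _ e = inj₂ e

forced≡false⇒ : ∀ t f d → forced t f d ≡ false → t ≡ false × (f ≡ true ⊎ d ≡ false)
forced≡false⇒ false true  _ _ = refl , inj₁ refl
forced≡false⇒ false false _ e = refl , inj₂ e

module Canonical {DS : SSet} (saturated : DownwardSaturated DS) where
  open DownwardSaturated saturated

  valuation : Formula → Bool
  valuation (var n)  = DS (T (var n))
  valuation (~ A)    = forced (DS (T (~ A))) (DS (F (~ A))) (not (valuation A))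
  valuation (A ⋀ B)  = valuation A ∧ valuation B
  valuation (A ⋁ B)  = valuation A ∨ valuation B
  valuation (A ⇒ B)  = not (valuation A) ∨ valuation B

  private
    v : Formula → Bool
    v = valuation

    F∈⇒T∉ : ∀ {A} → F A ∈ DS → DS (T A) ≡ false
    F∈⇒T∉ {A} h = ≢true⇒≡false (noConj (F A) h)

  T∈⇒true  : ∀ A → T A ∈ DS → v A ≡ true
  F∈⇒false : ∀ A → F A ∈ DS → v A ≡ false

  T∈⇒true (var n) h = h
  T∈⇒true (~ A)   h rewrite h = refl
  T∈⇒true (A ⋀ B) h
    rewrite T∈⇒true A (closed₁ _ _ (T∧₁ A B) h) | T∈⇒true B (closed₁ _ _ (T∧₂ A B) h) = refl
  T∈⇒true (A ⋁ B) h with analytic _ _ _ (T∨₁ A B) h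
  ... | inj₁ FA∈ rewrite T∈⇒true B (closed₂ _ _ _ (T∨₁ A B) h FA∈) = ∨-zeroʳ (v A)
  ... | inj₂ TA∈ rewrite T∈⇒true A TA∈ = refl
  T∈⇒true (A ⇒ B) h with analytic _ _ _ (T→₁ A B) h
  ... | inj₁ TA∈ rewrite T∈⇒true B (closed₂ _ _ _ (T→₁ A B) h TA∈) = ∨-zeroʳ (not (v A))
  ... | inj₂ FA∈ rewrite F∈⇒false A FA∈ = refl

  F∈⇒false (var n) h = F∈⇒T∉ h
  F∈⇒false (~ A)   h rewrite F∈⇒T∉ h | h = refl
  F∈⇒false (A ⋀ B) h with analytic _ _ _ (F∧₁ A B) h
  ... | inj₁ TA∈ rewrite F∈⇒false B (closed₂ _ _ _ (F∧₁ A B) h TA∈) = ∧-zeroʳ (v A)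
  ... | inj₂ FA∈ rewrite F∈⇒false A FA∈ = refl
  F∈⇒false (A ⋁ B) h
    rewrite F∈⇒false A (closed₁ _ _ (F∨₁ A B) h) | F∈⇒false B (closed₁ _ _ (F∨₂ A B) h) = refl
  F∈⇒false (A ⇒ B) h
    rewrite T∈⇒true A (closed₁ _ _ (F→₁ A B) h) | F∈⇒false B (closed₁ _ _ (F→₂ A B) h) = refl

  satisfies : ∀ s → s ∈ DS → valS v s ≡ true
  satisfies (T A) h = T∈⇒true A h
  satisfies (F A) h = ≡false⇒not≡true (F∈⇒false A h)

  ~-true⇒ : ∀ A → v (~ A) ≡ true → T (~ A) ∈ DS ⊎ v A ≡ false
  ~-true⇒ A h with forced≡true⇒ _ _ _ h
  ... | inj₁ T¬A∈ = inj₁ T¬A∈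
  ... | inj₂ e    = inj₂ (not≡true⇒≡false e)

  ~-false⇒ : ∀ A → v (~ A) ≡ false → DS (T (~ A)) ≡ false × (F (~ A) ∈ DS ⊎ v A ≡ true)
  ~-false⇒ A h with forced≡false⇒ _ _ _ h
  ... | T¬A∉ , inj₁ F¬A∈ = T¬A∉ , inj₁ F¬A∈
  ... | T¬A∉ , inj₂ e    = T¬A∉ , inj₂ (not≡false⇒≡true e)

  ∘-false⇒F∈ : ∀ A → v (∘ A) ≡ false → F (∘ A) ∈ DS
  -- If ∘A is false only by default, then A and ¬A are both true, so T ¬A ∈ DS,
  -- and the analyticity of T¬∘ puts T ∘A or F ∘A into DS.
  ∘-false⇒F∈ A h with ~-false⇒ (A ⋀ ~ A) h
  ... | _    , inj₁ F∘A∈ = F∘A∈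
  ... | T∘A∉ , inj₂ A∧¬A with to (∧≡true⇔ _ _) A∧¬A
  ...   | vA≡true , v¬A≡true with ~-true⇒ A v¬A≡true
  ...     | inj₂ vA≡false = true≢false vA≡true vA≡false
  ...     | inj₁ T¬A∈ with analytic _ _ _ (T¬∘ A) T¬A∈
  ...       | inj₁ T∘A∈ = true≢false T∘A∈ T∘A∉
  ...       | inj₂ F∘A∈ = F∘A∈

  ¬-clause : ∀ α → v (~ α) ≡ false → v α ≡ true
  ¬-clause α h with ~-false⇒ α h
  ... | _ , inj₁ F¬α∈   = T∈⇒true α (closed₁ _ _ (F¬ α) F¬α∈)
  ... | _ , inj₂ vα≡true = vα≡true

  ¬¬-clause : ∀ α → v (~ ~ α) ≡ true → v α ≡ true
  ¬¬-clause α h with ~-true⇒ (~ α) h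
  ... | inj₁ T¬¬α∈    = T∈⇒true α (closed₁ _ _ (T¬¬ α) T¬¬α∈)
  ... | inj₂ v¬α≡false = ¬-clause α v¬α≡false

  ∘-clause : ∀ α → v (∘ α) ≡ true → v α ≡ false ⊎ v (~ α) ≡ false
  ∘-clause α h with ~-true⇒ (α ⋀ ~ α) h
  ... | inj₂ α∧¬α≡false = ∧≡false⇒ _ _ α∧¬α≡false
  ... | inj₁ T∘α∈ with v (~ α) in v¬α
  ...   | false = inj₂ refl
  ...   | true with ~-true⇒ α v¬α
  ...     | inj₁ T¬α∈   = inj₁ (F∈⇒false α (closed₂ _ _ _ (T¬∘ α) T¬α∈ T∘α∈))
  ...     | inj₂ vα≡false = inj₁ vα≡false

  ∘⊘-clause : ∀ ⊘ α β → v (∘ (bin ⊘ α β)) ≡ false → v (∘ α) ≡ false ⊎ v (∘ β) ≡ false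
  ∘⊘-clause ⊘ α β h with ∘-false⇒F∈ (bin ⊘ α β) h
  ... | F∘X∈ with analytic _ _ _ (F∘₁ ⊘ α β) F∘X∈
  ...   | inj₁ T∘α∈ = inj₂ (F∈⇒false (∘ β) (closed₂ _ _ _ (F∘₁ ⊘ α β) F∘X∈ T∘α∈))
  ...   | inj₂ F∘α∈ = inj₁ (F∈⇒false (∘ α) F∘α∈)

  valuation-isC1 : IsC1Valuation valuation
  valuation-isC1 = record
    { v-∧  = λ α β → ∧≡true⇔ (v α) (v β)
    ; v-∨  = λ α β → ∨≡true⇔ (v α) (v β)
    ; v-→  = λ α β → not∨≡true⇔ (v α) (v β)
    ; v-¬  = ¬-clause
    ; v-¬¬ = ¬¬-clause
    ; v-∘  = ∘-clause
    ; v-∘⊘ = ∘⊘-clause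
    }

mainTheorem2 : (DS′ : SSet) →
    Satisfiable DS′ ⇔ Σ SSet (λ DS″ → DownwardSaturated DS″ × DS′ ⊆ DS″)
mainTheorem2 DS′ = mk⇔ soundness completeness
  where
  soundness : Satisfiable DS′ → Σ SSet (λ DS″ → DownwardSaturated DS″ × DS′ ⊆ DS″)
  soundness (v , isC1 , satisfied) = valS v , valS-downwardSaturated isC1 , satisfied

  completeness : Σ SSet (λ DS″ → DownwardSaturated DS″ × DS′ ⊆ DS″) → Satisfiable DS′
  completeness (DS″ , saturated , DS′⊆DS″) =
    valuation , valuation-isC1 , λ s s∈DS′ → satisfies s (DS′⊆DS″ s s∈DS′)
    where open Canonical saturated
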